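{- Any pair of elements $a$ and $b$ from an $\omega$-complete effect monoid $M$ has an infimum $a\wedge b$, given by $$a\wedge b = \sum_{n=1}^\infty a_n\cdot b_n \quad\text{where}\quad a_1=a,\ b_1=b,\ a_{n+1}=a_n\cdot b_n^\perp,\ b_{n+1}=a_n^\perp\cdot b_n.$$ Consequently, any pair also has a supremum given by $a\vee b=(a^\perp\wedge b^\perp)^\perp$.
   Context: An effect algebra is a set $E$ with an element $0$, a partial binary operation $a+b$ (the partial sum), and a total complement $a\mapsto a^\perp$, such that: the sum is commutative and associative wherever defined, $a+0=a$, $a^\perp$ is the unique element with $a+a^\perp=1$ where $1:=0^\perp$, and $a+1$ defined implies $a=0$. The order is $a\le b$ iff $b=a+c$ for some $c$. An effect monoid is an effect algebra with an associative total multiplication $\cdot$ with unit $1$ which distributes over the partial sum on both sides. It is $\omega$-complete if every increasing sequence has a supremum. For a family $(x_i)_{i\in I}$, the sum $\sum_{i\in I}x_i$ exists if every finite partial sum $\sum_{i\in S}x_i$ ($S\subseteq I$ finite) is defined and the supremum of these finite partial sums exists; the sum is then that supremum. -}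

module Defs where

open import Level using (Level; suc; _⊔_)
open import Data.Nat using (ℕ; zero) renaming (suc to sucℕ)
open import Data.Product using (Σ; _×_; _,_; proj₁; proj₂; ∃)
open import Data.List using (List; []; _∷_)
open import Data.List.Relation.Unary.Unique.Propositional using (Unique)
open import Relation.Binary.PropositionalEquality using (_≡_)

-- Effect algebra.  The partial sum is the ternary relation  Sum a b c
-- meaning "a + b is defined and equals c".
record EffectAlgebra (ℓ : Level) : Set (suc ℓ) where
  field
    Carrier : Set ℓ
    𝟘       : Carrier
    _ᗮ      : Carrier → Carrier
    Sum     : Carrier → Carrier → Carrier → Set ℓ

  𝟙 : Carrier
  𝟙 = 𝟘 ᗮ

  field
    sum-functional : ∀ {a b c c'} → Sum a b c → Sum a b c' → c ≡ c'
    sum-comm       : ∀ {a b c} → Sum a b c → Sum b a c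
    sum-assoc      : ∀ {a b c d e} → Sum a b d → Sum d c e →
                     Σ Carrier (λ f → Sum b c f × Sum a f e)
    sum-zero       : ∀ a → Sum a 𝟘 a
    ᗮ-sum          : ∀ a → Sum a (a ᗮ) 𝟙
    ᗮ-unique       : ∀ {a b} → Sum a b 𝟙 → b ≡ a ᗮ
    zero-one       : ∀ {a c} → Sum a 𝟙 c → a ≡ 𝟘

  _≤_ : Carrier → Carrier → Set ℓ
  a ≤ b = Σ Carrier (λ c → Sum a c b)

record EffectMonoid (ℓ : Level) : Set (suc ℓ) where
  field
    effectAlgebra : EffectAlgebra ℓ
  open EffectAlgebra effectAlgebra public
  field
    _·_      : Carrier → Carrier → Carrier
    ·-assoc  : ∀ x y z → (x · y) · z ≡ x · (y · z)
    ·-unitˡ  : ∀ x → 𝟙 · x ≡ x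
    ·-unitʳ  : ∀ x → x · 𝟙 ≡ x
    ·-distribˡ : ∀ x {a b c} → Sum a b c → Sum (x · a) (x · b) (x · c)
    ·-distribʳ : ∀ x {a b c} → Sum a b c → Sum (a · x) (b · x) (c · x)

module _ {ℓ : Level} (M : EffectMonoid ℓ) where
  open EffectMonoid M

  IsSupOf : (Carrier → Set ℓ) → Carrier → Set ℓ
  IsSupOf P s = (∀ t → P t → t ≤ s) × (∀ u → (∀ t → P t → t ≤ u) → s ≤ u)

  IsInfOf : (Carrier → Set ℓ) → Carrier → Set ℓ
  IsInfOf P s = (∀ t → P t → s ≤ t) × (∀ u → (∀ t → P t → u ≤ t) → u ≤ s)

  Pair : Carrier → Carrier → Carrier → Set ℓ
  Pair a b t = (t ≡ a) Data.Sum.⊎ (t ≡ b)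
    where import Data.Sum

  IsMeet : Carrier → Carrier → Carrier → Set ℓ
  IsMeet a b m = IsInfOf (Pair a b) m

  IsJoin : Carrier → Carrier → Carrier → Set ℓ
  IsJoin a b m = IsSupOf (Pair a b) m

  OmegaComplete : Set ℓ
  OmegaComplete = (f : ℕ → Carrier) → (∀ n → f n ≤ f (sucℕ n)) →
                  Σ Carrier (λ s → IsSupOf (λ t → Σ ℕ (λ n → f n ≡ t)) s)

  -- FinSum x S s : the finite partial sum Σ_{i ∈ S} x_i is defined and equals s
  -- (S a list of indices; elements added one at a time)
  FinSum : (ℕ → Carrier) → List ℕ → Carrier → Set ℓ
  FinSum x [] s = s ≡ 𝟘
  FinSum x (i ∷ S) s = Σ Carrier (λ t → FinSum x S t × Sum (x i) t s)

  -- t is a finite partial sum over some finite subset S ⊆ ℕ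
  -- (finite subsets = duplicate-free lists)
  PartialSum : (ℕ → Carrier) → Carrier → Set ℓ
  PartialSum x t = Σ (List ℕ) (λ S → Unique S × FinSum x S t)

  IsSumOf : (ℕ → Carrier) → Carrier → Set ℓ
  IsSumOf x s = (∀ (S : List ℕ) → Unique S → Σ Carrier (λ t → FinSum x S t))
              × IsSupOf (PartialSum x) s

  -- the sequences (a_n, b_n); index 0 here is index 1 in the paper
  seqAB : Carrier → Carrier → ℕ → Carrier × Carrier
  seqAB a b zero = (a , b)
  seqAB a b (sucℕ n) with seqAB a b n
  ... | (an , bn) = (an · (bn ᗮ) , (an ᗮ) · bn)

  meetTerm : Carrier → Carrier → ℕ → Carrier
  meetTerm a b n = proj₁ (seqAB a b n) · proj₂ (seqAB a b n)

module Submission where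

-- Put  s₀ = 𝟘  and  sₙ₊₁ = sₙ + aₙbₙ.  Splitting  aₙ = aₙbₙ + aₙ₊₁  and
-- bₙ = aₙbₙ + bₙ₊₁  shows  sₙ + aₙ = a  and  sₙ + bₙ = b  for all n, so the
-- increasing sequence (sₙ) has a supremum σ ≤ a, b, and σ is the sum of
-- the series Σₙ aₙbₙ (every finite partial sum lies below some sₖ).
-- Write  a = σ + a'  and  b = σ + b'.  Then a'b' lies below every aₙbₙ,
-- which forces a'b' = 𝟘.  In an ω-complete effect monoid orthogonal
-- elements are separated: there is p with  pb' = 𝟘  and  pᗮa' = 𝟘
-- (p is the supremum of r₀ = 𝟘, rₖ₊₁ = a' + rₖa'ᗮ).  Hence a common lower
-- bound c of a and b satisfies  c = pc + pᗮc ≤ pσ + pᗮσ = σ.  Finally,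
-- since complementation is an order-reversing involution, the complement
-- of a meet of complements is a join.

open import Defs
open import Level using (Level)
open import Data.Product using (Σ; _×_; _,_; proj₁; proj₂)
import Data.Nat as Nat
open import Data.Nat using (ℕ; zero; suc; _⊔_; _<_; _≤′_; ≤′-refl; ≤′-step)
import Data.Nat.Properties as NatP
open import Data.Sum using (_⊎_; inj₁; inj₂)
open import Data.List using (List; []; _∷_)
import Data.List.Relation.Unary.All as All
open import Data.List.Relation.Unary.All using (All; []; _∷_)
open import Data.List.Relation.Unary.AllPairs using ([]; _∷_)
open import Data.List.Relation.Unary.Unique.Propositional using (Unique)
open import Relation.Binary.PropositionalEquality
open import Relation.Nullary using (yes; no)

module IndexLists where

  initial : ℕ → List ℕ
  initial zero = []
  initial (suc n) = n ∷ initial n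

  initial-bounded : ∀ n → All (_< n) (initial n)
  initial-bounded zero = []
  initial-bounded (suc n) = NatP.≤-refl ∷ All.map NatP.m<n⇒m<1+n (initial-bounded n)

  initial-unique : ∀ n → Unique (initial n)
  initial-unique zero = []
  initial-unique (suc n) =
    All.map (λ k<n n≡k → NatP.<⇒≢ k<n (sym n≡k)) (initial-bounded n) ∷ initial-unique n

  bound : (S : List ℕ) → Σ ℕ (λ K → All (_< K) S)
  bound [] = 0 , []
  bound (i ∷ S) with bound S
  ... | K , S<K = suc i ⊔ K , NatP.m≤m⊔n (suc i) K
                            ∷ All.map (λ j<K → NatP.<-≤-trans j<K (NatP.m≤n⊔m (suc i) K)) S<K

  remove : ℕ → List ℕ → List ℕ
  remove k [] = []
  remove k (j ∷ S) with j Nat.≟ k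
  ... | yes _ = S
  ... | no _ = j ∷ remove k S

  All-remove : ∀ {P : ℕ → Set} k S → All P S → All P (remove k S)
  All-remove k [] [] = []
  All-remove k (j ∷ S) (pj ∷ pS) with j Nat.≟ k
  ... | yes _ = pS
  ... | no _ = pj ∷ All-remove k S pS

  remove-top : ∀ k S → Unique S → All (_< suc k) S →
               Unique (remove k S) × All (_< k) (remove k S)
  remove-top k [] _ _ = [] , []
  remove-top k (j ∷ S) (j∉S ∷ uS) (j≤k ∷ S≤k) with j Nat.≟ k
  ... | yes refl = uS , All.zipWith below-top (j∉S , S≤k)
    where
    below-top : ∀ {i} → k ≢ i × i < suc k → i < k
    below-top (k≢i , i<1+k) = NatP.≤∧≢⇒< (NatP.≤-pred i<1+k) (λ i≡k → k≢i (sym i≡k))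
  ... | no j≢k with remove-top k S uS S≤k
  ...   | uS' , S'<k = (All-remove k S j∉S ∷ uS') , (NatP.≤∧≢⇒< (NatP.≤-pred j≤k) j≢k ∷ S'<k)

open IndexLists

-- Order theory of an effect algebra.
module EffectAlgebraFacts {ℓ : Level} (E : EffectAlgebra ℓ) where
  open EffectAlgebra E

  sum-zeroˡ : ∀ a → Sum 𝟘 a a
  sum-zeroˡ a = sum-comm (sum-zero a)

  sum-assocʳ : ∀ {a b c f e} → Sum b c f → Sum a f e → Σ Carrier (λ d → Sum a b d × Sum d c e)
  sum-assocʳ bc af with sum-assoc (sum-comm bc) (sum-comm af)
  ... | g , ba , cg = g , sum-comm ba , sum-comm cg

  -- a is a complement of aᗮ, hence equals aᗮᗮ
  ᗮ-involutive : ∀ a → (a ᗮ) ᗮ ≡ a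
  ᗮ-involutive a = sym (ᗮ-unique (sum-comm (ᗮ-sum a)))

  -- cancellation, obtained by adding (a + b)ᗮ and using uniqueness of complements
  sum-cancelˡ : ∀ {a b b' c} → Sum a b c → Sum a b' c → b ≡ b'
  sum-cancelˡ ab ab' with sum-assoc (sum-comm ab) (ᗮ-sum _) | sum-assoc (sum-comm ab') (ᗮ-sum _)
  ... | f , acf , bf1 | f' , acf' , bf'1 =
    trans (ᗮ-unique (sum-comm bf1))
      (trans (cong _ᗮ (sum-functional acf acf')) (sym (ᗮ-unique (sum-comm bf'1))))

  sum-positive : ∀ {a b} → Sum a b 𝟘 → a ≡ 𝟘
  sum-positive {a} ab0 with sum-assoc ab0 (sum-zeroˡ 𝟙)
  ... | f , b1f , af1 with zero-one b1f
  ... | refl = sym (sum-functional ab0 (sum-zero a))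

  ≤-refl : ∀ a → a ≤ a
  ≤-refl a = 𝟘 , sum-zero a

  ≤-trans : ∀ {a b c} → a ≤ b → b ≤ c → a ≤ c
  ≤-trans (d , adb) (e , bec) with sum-assoc adb bec
  ... | f , _ , afc = f , afc

  ≤-antisym : ∀ {a b} → a ≤ b → b ≤ a → a ≡ b
  ≤-antisym {a} (d , adb) (e , bea) with sum-assoc adb bea
  ... | f , def , afa with sum-cancelˡ afa (sum-zero a)
  ... | refl with sum-positive def
  ... | refl = sum-functional (sum-zero a) adb

  𝟘-least : ∀ a → 𝟘 ≤ a
  𝟘-least a = a , sum-zeroˡ a

  ≤-𝟘 : ∀ {a} → a ≤ 𝟘 → a ≡ 𝟘
  ≤-𝟘 (_ , ad0) = sum-positive ad0

  sum-monoˡ : ∀ {a a' b c'} → a ≤ a' → Sum a' b c' → Σ Carrier (λ c → Sum a b c × c ≤ c')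
  sum-monoˡ (d , ada') a'bc' with sum-assoc ada' a'bc'
  ... | f , dbf , afc' with sum-assocʳ (sum-comm dbf) afc'
  ... | c , abc , cdc' = c , abc , (d , cdc')

  sum-mono : ∀ {a a' b b' c'} → a ≤ a' → b ≤ b' → Sum a' b' c' →
             Σ Carrier (λ c → Sum a b c × c ≤ c')
  sum-mono a≤a' b≤b' a'b'c' with sum-monoˡ a≤a' a'b'c'
  ... | c₁ , ab'c₁ , c₁≤c' with sum-monoˡ b≤b' (sum-comm ab'c₁)
  ... | c , bac , c≤c₁ = c , sum-comm bac , ≤-trans c≤c₁ c₁≤c'

  sum-mono-≤ : ∀ {a a' b b' c c'} → a ≤ a' → b ≤ b' → Sum a b c → Sum a' b' c' → c ≤ c'
  sum-mono-≤ {a} {b = b} {c = c} {c'} a≤a' b≤b' abc a'b'c' = known (sum-mono a≤a' b≤b' a'b'c')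
    where
    known : Σ Carrier (λ v → Sum a b v × v ≤ c') → c ≤ c'
    known (v , abv , v≤c') = subst (_≤ _) (sum-functional abv abc) v≤c'

  sum-cancel-≤ : ∀ {a x x' y y'} → Sum a x y → Sum a x' y' → y ≤ y' → x ≤ x'
  sum-cancel-≤ axy ax'y' (e , yey') with sum-assoc axy yey'
  ... | f , xef , afy' with sum-cancelˡ afy' ax'y'
  ... | refl = e , xef

  remainder-antitone : ∀ {s s' x x' a} → Sum s x a → Sum s' x' a → s ≤ s' → x' ≤ x
  remainder-antitone sxa s'x'a (e , ses') with sum-assoc ses' s'x'a
  ... | f , ex'f , sfa with sum-cancelˡ sfa sxa
  ... | refl = e , sum-comm ex'f

  absorbed⇒zero : ∀ {x r σ} → Sum x r σ → σ ≤ r → x ≡ 𝟘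
  absorbed⇒zero {x} {r} xrσ σ≤r with ≤-antisym σ≤r (x , sum-comm xrσ)
  ... | refl = sum-cancelˡ (sum-comm xrσ) (sum-zero r)

  ᗮ-antitone : ∀ {a b} → a ≤ b → (b ᗮ) ≤ (a ᗮ)
  ᗮ-antitone {a} {b} (d , adb) with sum-assoc adb (ᗮ-sum b)
  ... | f , dbᗮf , af1 with ᗮ-unique af1
  ... | refl = d , sum-comm dbᗮf

  sum-squeeze : ∀ {q q' r r' p} → q ≤ q' → r ≤ r' → Sum q r p → Sum q' r' p → q ≡ q'
  sum-squeeze {q} {r = r} (d₁ , qd₁q') (d₂ , rd₂r') qrp q'r'p with sum-assoc qd₁q' q'r'p
  ... | f , d₁r'f , qfp with sum-cancelˡ qfp qrp
  ... | refl with ≤-antisym (d₂ , rd₂r') (d₁ , sum-comm d₁r'f)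
  ... | refl with sum-cancelˡ (sum-comm d₁r'f) (sum-zero r)
  ... | refl = sum-functional (sum-zero q) qd₁q'

  Increasing : (ℕ → Carrier) → Set ℓ
  Increasing f = ∀ n → f n ≤ f (suc n)

  IsSupSeq : (ℕ → Carrier) → Carrier → Set ℓ
  IsSupSeq f σ = (∀ n → f n ≤ σ) × (∀ u → (∀ n → f n ≤ u) → σ ≤ u)

  increasing-mono′ : ∀ {f} → Increasing f → ∀ {m n} → m ≤′ n → f m ≤ f n
  increasing-mono′ inc ≤′-refl = ≤-refl _
  increasing-mono′ inc (≤′-step m≤′n) = ≤-trans (increasing-mono′ inc m≤′n) (inc _)

  increasing-mono : ∀ {f} → Increasing f → ∀ {m n} → m Nat.≤ n → f m ≤ f n
  increasing-mono inc m≤n = increasing-mono′ inc (NatP.≤⇒≤′ m≤n)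

  sup-tail : ∀ {f σ} → Increasing f → IsSupSeq f σ → IsSupSeq (λ n → f (suc n)) σ
  sup-tail {f} inc (f≤σ , least) = (λ n → f≤σ (suc n)) , λ u above → least u (bounded u above)
    where
    bounded : ∀ u → (∀ n → f (suc n) ≤ u) → ∀ n → f n ≤ u
    bounded u above zero = ≤-trans (inc 0) (above 0)
    bounded u above (suc n) = above n

  sup-const : ∀ a → IsSupSeq (λ _ → a) a
  sup-const a = (λ _ → ≤-refl a) , (λ u above → above 0)

  sum-sup-bounded : ∀ {a z σ y} → IsSupSeq y σ → a ≤ z →
                    (∀ m → Σ Carrier (λ w → Sum a (y m) w × w ≤ z)) →
                    Σ Carrier (λ w → Sum σ a w × w ≤ z)
  sum-sup-bounded {y = y} (_ , least) (g , agz) bounded with least g y≤g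
    where
    y≤g : ∀ m → y m ≤ g
    y≤g m with bounded m
    ... | w , ayw , w≤z = sum-cancel-≤ ayw agz w≤z
  ... | h , σhg with sum-assocʳ σhg agz
  ... | w , aσw , whz = w , sum-comm aσw , (h , whz)

  sup-additive : ∀ {x y z σx σy σz} → Increasing x → Increasing y →
                 (∀ k → Sum (x k) (y k) (z k)) →
                 IsSupSeq x σx → IsSupSeq y σy → IsSupSeq z σz → Sum σx σy σz
  sup-additive {x} {y} {z} {σx} {σy} {σz} incx incy xyz supx supy (z≤σz , leastz) =
    subst (Sum σx σy) (≤-antisym w≤σz σz≤w) σxσyw
    where
    pairwise : ∀ n m → Σ Carrier (λ w → Sum (x n) (y m) w × w ≤ σz)
    pairwise n m with sum-mono (increasing-mono incx (NatP.m≤m⊔n n m))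
                               (increasing-mono incy (NatP.m≤n⊔m n m)) (xyz (n ⊔ m))
    ... | w , sw , w≤ = w , sw , ≤-trans w≤ (z≤σz (n ⊔ m))

    with-σy : ∀ n → Σ Carrier (λ w → Sum σy (x n) w × w ≤ σz)
    with-σy n = sum-sup-bounded supy (≤-trans (y n , xyz n) (z≤σz n)) (pairwise n)

    σy≤σz : σy ≤ σz
    σy≤σz = ≤-trans (x 0 , proj₁ (proj₂ (with-σy 0))) (proj₂ (proj₂ (with-σy 0)))

    total : Σ Carrier (λ w → Sum σx σy w × w ≤ σz)
    total = sum-sup-bounded supx σy≤σz with-σy

    w : Carrier
    w = proj₁ total

    σxσyw : Sum σx σy w
    σxσyw = proj₁ (proj₂ total)

    w≤σz : w ≤ σz
    w≤σz = proj₂ (proj₂ total)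

    σz≤w : σz ≤ w
    σz≤w = leastz w (λ k → sum-mono-≤ (proj₁ supx k) (proj₁ supy k) (xyz k) σxσyw)

-- Elementary facts about effect monoids, and sums of series.
module EffectMonoidFacts {ℓ : Level} (M : EffectMonoid ℓ) where
  open EffectMonoid M
  open EffectAlgebraFacts effectAlgebra

  ·-monoˡ : ∀ w {u v} → u ≤ v → (w · u) ≤ (w · v)
  ·-monoˡ w (d , udv) = w · d , ·-distribˡ w udv

  ·-monoʳ : ∀ w {u v} → u ≤ v → (u · w) ≤ (v · w)
  ·-monoʳ w (d , udv) = d · w , ·-distribʳ w udv

  ·-zeroˡ : ∀ x → 𝟘 · x ≡ 𝟘
  ·-zeroˡ x = sum-cancelˡ (·-distribʳ x (sum-zero 𝟘)) (sum-zero (𝟘 · x))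

  ᗮ-splitˡ : ∀ p x → Sum (p · x) ((p ᗮ) · x) x
  ᗮ-splitˡ p x = subst (Sum (p · x) ((p ᗮ) · x)) (·-unitˡ x) (·-distribʳ x (ᗮ-sum p))

  ᗮ-splitʳ : ∀ x y → Sum (x · y) (x · (y ᗮ)) x
  ᗮ-splitʳ x y = subst (Sum (x · y) (x · (y ᗮ))) (·-unitʳ x) (·-distribˡ x (ᗮ-sum y))

  ᗮ-fixes : ∀ {p x} → p · x ≡ 𝟘 → (p ᗮ) · x ≡ x
  ᗮ-fixes {p} {x} px≡𝟘 =
    sum-cancelˡ (subst (λ u → Sum u ((p ᗮ) · x) x) px≡𝟘 (ᗮ-splitˡ p x)) (sum-zeroˡ x)

  ᗮ-kills : ∀ {p x} → p · x ≡ x → (p ᗮ) · x ≡ 𝟘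
  ᗮ-kills {p} {x} px≡x =
    sum-cancelˡ (subst (λ u → Sum u ((p ᗮ) · x) x) px≡x (ᗮ-splitˡ p x)) (sum-zero x)

  ·-ignores : ∀ {p m y' y} → Sum m y' y → p · y' ≡ 𝟘 → p · y ≡ p · m
  ·-ignores {p} {m} my'y py'≡𝟘 =
    sum-functional (·-distribˡ p my'y)
                   (subst (λ v → Sum (p · m) v (p · m)) (sym py'≡𝟘) (sum-zero (p · m)))

  -- If x = m + x' and y = m + y' where p annihilates y' and pᗮ annihilates x',
  -- then m is the greatest lower bound of x and y:  c = pc + pᗮc ≤ pm + pᗮm = m.
  separated⇒greatest : ∀ {m x x' y y' p c} → Sum m x' x → Sum m y' y →
                       p · y' ≡ 𝟘 → (p ᗮ) · x' ≡ 𝟘 → c ≤ x → c ≤ y → c ≤ m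
  separated⇒greatest {m} {p = p} {c} mx'x my'y py'≡𝟘 pᗮx'≡𝟘 c≤x c≤y =
    sum-mono-≤ pc≤pm pᗮc≤pᗮm (ᗮ-splitˡ p c) (ᗮ-splitˡ p m)
    where
    pc≤pm : (p · c) ≤ (p · m)
    pc≤pm = subst ((p · c) ≤_) (·-ignores my'y py'≡𝟘) (·-monoˡ p c≤y)
    pᗮc≤pᗮm : ((p ᗮ) · c) ≤ ((p ᗮ) · m)
    pᗮc≤pᗮm = subst (((p ᗮ) · c) ≤_) (·-ignores mx'x pᗮx'≡𝟘) (·-monoˡ (p ᗮ) c≤x)

  meet-of-complements⇒join : ∀ a b m → IsMeet M (a ᗮ) (b ᗮ) m → IsJoin M a b (m ᗮ)
  meet-of-complements⇒join a b m (lower , greatest) = upper , least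
    where
    upper : ∀ t → Pair M a b t → t ≤ (m ᗮ)
    upper t (inj₁ refl) = subst (_≤ (m ᗮ)) (ᗮ-involutive a) (ᗮ-antitone (lower _ (inj₁ refl)))
    upper t (inj₂ refl) = subst (_≤ (m ᗮ)) (ᗮ-involutive b) (ᗮ-antitone (lower _ (inj₂ refl)))
    least : ∀ u → (∀ t → Pair M a b t → t ≤ u) → (m ᗮ) ≤ u
    least u above = subst ((m ᗮ) ≤_) (ᗮ-involutive u) (ᗮ-antitone (greatest (u ᗮ) below))
      where
      below : ∀ t → Pair M (a ᗮ) (b ᗮ) t → (u ᗮ) ≤ t
      below t (inj₁ refl) = ᗮ-antitone (above a (inj₁ refl))
      below t (inj₂ refl) = ᗮ-antitone (above b (inj₂ refl))

  -- A series Σₙ xₙ whose initial partial sums sₙ = x₀ + … + xₙ₋₁ have a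
  -- supremum σ has sum σ: each finite partial sum over S lies below s_K
  -- for any bound K of S, and the sₙ are themselves finite partial sums.
  module Series {x s : ℕ → Carrier} (s₀ : s 0 ≡ 𝟘)
                (step : ∀ n → Sum (s n) (x n) (s (suc n))) where

    FinSum-functional : ∀ S {u v} → FinSum M x S u → FinSum M x S v → u ≡ v
    FinSum-functional [] u≡𝟘 v≡𝟘 = trans u≡𝟘 (sym v≡𝟘)
    FinSum-functional (i ∷ S) (u' , fu' , su) (v' , fv' , sv) with FinSum-functional S fu' fv'
    ... | refl = sum-functional su sv

    FinSum-initial : ∀ n → FinSum M x (initial n) (s n)
    FinSum-initial zero = s₀
    FinSum-initial (suc n) = s n , FinSum-initial n , sum-comm (step n)

    FinSum-remove : ∀ k S → (remove k S ≡ S) ⊎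
                    (∀ {t u} → FinSum M x (remove k S) t → Sum (x k) t u → FinSum M x S u)
    FinSum-remove k [] = inj₁ refl
    FinSum-remove k (j ∷ S) with j Nat.≟ k
    ... | yes refl = inj₂ (λ {t} fst xtu → t , fst , xtu)
    ... | no _ with FinSum-remove k S
    ...   | inj₁ same = inj₁ (cong (j ∷_) same)
    ...   | inj₂ insert = inj₂ insert-j
      where
      insert-j : ∀ {t u} → FinSum M x (j ∷ remove k S) t → Sum (x k) t u → FinSum M x (j ∷ S) u
      insert-j (v , fv , xjvt) xktu with sum-assoc xjvt (sum-comm xktu)
      ... | w , vxkw , xjwu = w , insert fv (sum-comm vxkw) , xjwu

    finite-sum-below : ∀ K S → Unique S → All (_< K) S →
                       Σ Carrier (λ u → FinSum M x S u × u ≤ s K)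
    finite-sum-below zero [] _ _ = 𝟘 , refl , 𝟘-least (s 0)
    finite-sum-below zero (j ∷ S) _ (() ∷ _)
    finite-sum-below (suc K) S uS S<K with remove-top K S uS S<K
    ... | uS' , S'<K with finite-sum-below K (remove K S) uS' S'<K | FinSum-remove K S
    ...   | v , fv , v≤sK | inj₁ same =
              v , subst (λ L → FinSum M x L v) same fv , ≤-trans v≤sK (x K , step K)
    ...   | v , fv , v≤sK | inj₂ insert =
              proj₁ vx , insert fv (sum-comm (proj₁ (proj₂ vx))) , proj₂ (proj₂ vx)
      where
      vx : Σ Carrier (λ w → Sum v (x K) w × w ≤ s (suc K))
      vx = sum-mono v≤sK (≤-refl (x K)) (step K)

    series-sum : ∀ {σ} → IsSupSeq s σ → IsSumOf M x σ
    series-sum {σ} (s≤σ , least) =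
      defined , upper , λ u above → least u (λ n → above (s n) (initial-partial n))
      where
      below : ∀ S → Unique S → Σ Carrier (λ u → FinSum M x S u × u ≤ s (proj₁ (bound S)))
      below S uS = finite-sum-below (proj₁ (bound S)) S uS (proj₂ (bound S))

      defined : ∀ S → Unique S → Σ Carrier (λ u → FinSum M x S u)
      defined S uS = proj₁ (below S uS) , proj₁ (proj₂ (below S uS))

      upper : ∀ u → PartialSum M x u → u ≤ σ
      upper u (S , uS , fu) with below S uS
      ... | v , fv , v≤sK rewrite FinSum-functional S fu fv = ≤-trans v≤sK (s≤σ _)

      initial-partial : ∀ n → PartialSum M x (s n)
      initial-partial n = initial n , initial-unique n , FinSum-initial n

  -- Consequences of ω-completeness.
  module Complete (ωc : OmegaComplete M) where

    sup : ∀ f → Increasing f → Σ Carrier (IsSupSeq f)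
    sup f inc with ωc f inc
    ... | σ , upper , least =
      σ , (λ n → upper (f n) (n , refl)) , (λ u above → least u (λ { _ (n , refl) → above n }))

    -- right multiplication is ω-continuous: writing fₖ = fₖx + fₖxᗮ, the
    -- suprema of the two parts add up to sup fₖ = σx + σxᗮ, so they are σx, σxᗮ
    ·-continuousʳ : ∀ {f σ} → Increasing f → IsSupSeq f σ → ∀ x → IsSupSeq (λ k → f k · x) (σ · x)
    ·-continuousʳ {f} {σ} inc (f≤σ , leastf) x = subst (IsSupSeq (λ k → f k · x)) q≡σx supq
      where
      incq : Increasing (λ k → f k · x)
      incq k = ·-monoʳ x (inc k)
      incr : Increasing (λ k → f k · (x ᗮ))
      incr k = ·-monoʳ (x ᗮ) (inc k)
      q r : Carrier
      q = proj₁ (sup _ incq)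
      r = proj₁ (sup _ incr)
      supq : IsSupSeq (λ k → f k · x) q
      supq = proj₂ (sup _ incq)
      supr : IsSupSeq (λ k → f k · (x ᗮ)) r
      supr = proj₂ (sup _ incr)
      q≡σx : q ≡ σ · x
      q≡σx = sum-squeeze (proj₂ supq (σ · x) (λ k → ·-monoʳ x (f≤σ k)))
                         (proj₂ supr (σ · (x ᗮ)) (λ k → ·-monoʳ (x ᗮ) (f≤σ k)))
                         (sup-additive incq incr (λ k → ᗮ-splitʳ (f k) x) supq supr (f≤σ , leastf))
                         (ᗮ-splitʳ σ x)

    -- Orthogonal elements are separated by a sharp cut: if ab = 𝟘 there is p
    -- with pb = 𝟘 and pᗮa = 𝟘.  Take p = sup rₖ, r₀ = 𝟘, rₖ₊₁ = a + rₖaᗮ;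
    -- then rₖb = 𝟘 (as aᗮb = b) and p = a + paᗮ, whence pa = a.
    separation : ∀ {a b} → a · b ≡ 𝟘 → Σ Carrier (λ p → p · b ≡ 𝟘 × (p ᗮ) · a ≡ 𝟘)
    separation {a} {b} ab≡𝟘 = p , pb≡𝟘 , ᗮ-kills pa≡a
      where
      -- a + yaᗮ is defined since yaᗮ ≤ aᗮ
      extend : ∀ y → Σ Carrier (λ c → Sum a (y · (a ᗮ)) c)
      extend y = proj₁ bounded , proj₁ (proj₂ bounded)
        where
        yaᗮ≤aᗮ : (y · (a ᗮ)) ≤ (a ᗮ)
        yaᗮ≤aᗮ = subst ((y · (a ᗮ)) ≤_) (·-unitˡ (a ᗮ)) (·-monoʳ (a ᗮ) (y ᗮ , ᗮ-sum y))
        bounded : Σ Carrier (λ c → Sum a (y · (a ᗮ)) c × c ≤ 𝟙)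
        bounded = sum-mono (≤-refl a) yaᗮ≤aᗮ (ᗮ-sum a)

      r : ℕ → Carrier
      r zero = 𝟘
      r (suc k) = proj₁ (extend (r k))

      r-step : ∀ k → Sum a (r k · (a ᗮ)) (r (suc k))
      r-step k = proj₂ (extend (r k))

      r-inc : Increasing r
      r-inc zero = 𝟘-least _
      r-inc (suc k) = sum-mono-≤ (≤-refl a) (·-monoʳ (a ᗮ) (r-inc k)) (r-step k) (r-step (suc k))

      rb≡𝟘 : ∀ k → r k · b ≡ 𝟘
      rb≡𝟘 zero = ·-zeroˡ b
      rb≡𝟘 (suc k) = sum-functional (subst₂ (λ u v → Sum u v (r (suc k) · b)) ab≡𝟘 raᗮb≡𝟘
                                            (·-distribʳ b (r-step k)))
                                    (sum-zero 𝟘)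
        where
        raᗮb≡𝟘 : (r k · (a ᗮ)) · b ≡ 𝟘
        raᗮb≡𝟘 = begin
          (r k · (a ᗮ)) · b ≡⟨ ·-assoc (r k) (a ᗮ) b ⟩
          r k · ((a ᗮ) · b) ≡⟨ cong (r k ·_) (ᗮ-fixes ab≡𝟘) ⟩
          r k · b           ≡⟨ rb≡𝟘 k ⟩
          𝟘                 ∎
          where open ≡-Reasoning

      p : Carrier
      p = proj₁ (sup r r-inc)
      supr : IsSupSeq r p
      supr = proj₂ (sup r r-inc)

      pb≡𝟘 : p · b ≡ 𝟘
      pb≡𝟘 = ≤-𝟘 (proj₂ (·-continuousʳ r-inc supr b) 𝟘 rb≤𝟘)
        where
        rb≤𝟘 : ∀ k → (r k · b) ≤ 𝟘
        rb≤𝟘 k = subst (_≤ 𝟘) (sym (rb≡𝟘 k)) (≤-refl 𝟘)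

      -- passing to the supremum in  rₖ₊₁ = a + rₖaᗮ
      p-fixpoint : Sum a (p · (a ᗮ)) p
      p-fixpoint = sup-additive (λ _ → ≤-refl a) (λ k → ·-monoʳ (a ᗮ) (r-inc k)) r-step
                     (sup-const a) (·-continuousʳ r-inc supr (a ᗮ)) (sup-tail r-inc supr)

      pa≡a : p · a ≡ a
      pa≡a = sum-cancelˡ (sum-comm (ᗮ-splitʳ p a)) (sum-comm p-fixpoint)

    module Meet (a b : Carrier) where

      aₙ bₙ t : ℕ → Carrier
      aₙ n = proj₁ (seqAB M a b n)
      bₙ n = proj₂ (seqAB M a b n)
      t = meetTerm M a b

      split-a : ∀ n → Sum (t n) (aₙ (suc n)) (aₙ n)
      split-a n = ᗮ-splitʳ (aₙ n) (bₙ n)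
      split-b : ∀ n → Sum (t n) (bₙ (suc n)) (bₙ n)
      split-b n = ᗮ-splitˡ (aₙ n) (bₙ n)

      -- the common part sₙ with  sₙ + aₙ = a  and  sₙ + bₙ = b;  the next one is
      -- sₙ + tₙ, computed on the a-side and equal to the one on the b-side
      CommonPart : ℕ → Set ℓ
      CommonPart n = Σ Carrier (λ s → Sum s (aₙ n) a × Sum s (bₙ n) b)

      next : ∀ n → CommonPart n → CommonPart (suc n)
      next n (s , sa , sb) = proj₁ viaA , proj₂ (proj₂ viaA) ,
                             subst (λ d → Sum d (bₙ (suc n)) b) same (proj₂ (proj₂ viaB))
        where
        viaA : Σ Carrier (λ d → Sum s (t n) d × Sum d (aₙ (suc n)) a)
        viaA = sum-assocʳ (split-a n) sa
        viaB : Σ Carrier (λ d → Sum s (t n) d × Sum d (bₙ (suc n)) b)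
        viaB = sum-assocʳ (split-b n) sb
        same : proj₁ viaB ≡ proj₁ viaA
        same = sum-functional (proj₁ (proj₂ viaB)) (proj₁ (proj₂ viaA))

      common : ∀ n → CommonPart n
      common zero = 𝟘 , sum-zeroˡ a , sum-zeroˡ b
      common (suc n) = next n (common n)

      s : ℕ → Carrier
      s n = proj₁ (common n)

      s+a : ∀ n → Sum (s n) (aₙ n) a
      s+a n = proj₁ (proj₂ (common n))
      s+b : ∀ n → Sum (s n) (bₙ n) b
      s+b n = proj₂ (proj₂ (common n))

      s-step : ∀ n → Sum (s n) (t n) (s (suc n))
      s-step n = proj₁ (proj₂ (sum-assocʳ (split-a n) (s+a n)))

      s-inc : Increasing s
      s-inc n = t n , s-step n

      σ : Carrier
      σ = proj₁ (sup s s-inc)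
      supσ : IsSupSeq s σ
      supσ = proj₂ (sup s s-inc)

      σ-sum : IsSumOf M t σ
      σ-sum = Series.series-sum refl s-step supσ

      σ≤a : σ ≤ a
      σ≤a = proj₂ supσ a (λ n → aₙ n , s+a n)
      σ≤b : σ ≤ b
      σ≤b = proj₂ supσ b (λ n → bₙ n , s+b n)

      a' b' : Carrier
      a' = proj₁ σ≤a
      b' = proj₁ σ≤b

      -- a'b' lies below every tₙ, so σ + a'b' ≤ σ, forcing a'b' = 𝟘
      remainders-orthogonal : a' · b' ≡ 𝟘
      remainders-orthogonal = absorbed⇒zero (proj₂ x≤σ) (proj₂ supσ _ s≤rest)
        where
        x : Carrier
        x = a' · b'
        x≤t : ∀ n → x ≤ t n
        x≤t n = ≤-trans (·-monoˡ a' (remainder-antitone (s+b n) (proj₂ σ≤b) (proj₁ supσ n)))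
                        (·-monoʳ (bₙ n) (remainder-antitone (s+a n) (proj₂ σ≤a) (proj₁ supσ n)))
        x≤σ : x ≤ σ
        x≤σ = ≤-trans (x≤t 0) (≤-trans (s 0 , sum-comm (s-step 0)) (proj₁ supσ 1))
        s≤rest : ∀ n → s n ≤ proj₁ x≤σ
        s≤rest n = sum-cancel-≤ (sum-comm (proj₁ (proj₂ sx≤s′))) (proj₂ x≤σ)
                                (≤-trans (proj₂ (proj₂ sx≤s′)) (proj₁ supσ (suc n)))
          where
          sx≤s′ : Σ Carrier (λ w → Sum (s n) x w × w ≤ s (suc n))
          sx≤s′ = sum-mono (≤-refl (s n)) (x≤t n) (s-step n)

      σ-greatest : ∀ c → c ≤ a → c ≤ b → c ≤ σ
      σ-greatest c =
        separated⇒greatest (proj₂ σ≤a) (proj₂ σ≤b) (proj₁ (proj₂ cut)) (proj₂ (proj₂ cut))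
        where
        cut : Σ Carrier (λ p → p · b' ≡ 𝟘 × (p ᗮ) · a' ≡ 𝟘)
        cut = separation remainders-orthogonal

      σ-meet : IsMeet M a b σ
      σ-meet = (λ { _ (inj₁ refl) → σ≤a ; _ (inj₂ refl) → σ≤b }) ,
               (λ c below → σ-greatest c (below a (inj₁ refl)) (below b (inj₂ refl)))

theorem37 : {ℓ : Level} (M : EffectMonoid ℓ) → OmegaComplete M →
    (a b : EffectMonoid.Carrier M) →
    Σ (EffectMonoid.Carrier M) (λ m → IsSumOf M (meetTerm M a b) m × IsMeet M a b m)
    × ((m : EffectMonoid.Carrier M) →
    IsMeet M (EffectMonoid._ᗮ M a) (EffectMonoid._ᗮ M b) m →
    IsJoin M a b (EffectMonoid._ᗮ M m))
theorem37 M ωc a b = (σ , σ-sum , σ-meet) , meet-of-complements⇒join a b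
  where
  open EffectMonoidFacts M
  open Complete ωc
  open Meet a b
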